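{- Let $G=(V,E)$ be a graph with $n=|V|$ and $m=|E|$, and let $D=(P_0,\dots,P_{m-n})$ be a (2,1)-edge-order of $G$ through $rt$ and avoiding $ru$. Then for every $0\le i<m-n$, the graph $\overline{G_i}$ is connected.
   Context: Graphs are finite and undirected and may contain parallel edges and self-loops; cycles may have length one or two. An ear decomposition of $G$ is a sequence $(P_0,P_1,\dots,P_k)$ of subgraphs of $G$ that partition $E$ such that (i) $P_0$ is a cycle that is not a self-loop, and (ii) every $P_i$, $1\le i\le k$, is either a path that intersects $P_0\cup\dots\cup P_{i-1}$ exactly in its endpoints, or a cycle that intersects $P_0\cup\dots\cup P_{i-1}$ in exactly one vertex $q_i$ (also called an endpoint of $P_i$). Each $P_i$ is an ear; it is short if it consists of a single edge and long otherwise. An ear decomposition of a connected graph has exactly $m-n+1$ ears, indexed $0,\dots,m-n$. Let $G_i=(V_i,E_i):=P_0\cup\dots\cup P_i$, let $\overline{E_i}:=E-E_i$, and let $\overline{G_i}$ be the subgraph of $G$ induced by the edge set $\overline{E_i}$ (its vertices are exactly the endpoints of edges in $\overline{E_i}$). The inner vertices of $P_i$ are $inner(P_i):=V(P_i)-V(G_{i-1})$ (all vertices of $P_0$ are inner). Given distinct edges $rt$ and $ru$ of $G$ ($t=u$ allowed), a (2,1)-edge-order through $rt$ and avoiding $ru$ is an ear decomposition $D=(P_0,\dots,P_{m-n})$ of $G$ such that (1) $rt\in P_0$; (2) $P_{m-n}$ is the short ear $ru$; (3) for every $0\le i<m-n$, $\overline{G_i}$ contains all vertices of $inner(P_i)$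 and, if $P_i$ is short, at least one endpoint of $P_i$. -}

module Defs where

open import Data.Nat using (ℕ; zero; suc; _<_; _∸_)
open import Data.Fin using (Fin; toℕ; fromℕ)
import Data.Fin as Fin
open import Data.Product using (_×_; _,_; proj₁; proj₂; ∃; ∃-syntax; Σ)
open import Data.Sum using (_⊎_)
open import Data.Unit using (⊤)
open import Data.Empty using (⊥)
open import Data.List using (List; []; _∷_; map; length)
open import Data.List.Membership.Propositional using (_∈_)
open import Data.List.Relation.Unary.All using (All)
open import Data.List.Relation.Unary.Unique.Propositional using (Unique)
open import Relation.Nullary using (¬_)
open import Relation.Binary.PropositionalEquality using (_≡_; _≢_)

-- A finite undirected multigraph (parallel edges and self-loops allowed):
-- vertices Fin n, edges Fin m, each edge has an (unordered) pair of endpoints.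
record Graph : Set where
  field
    n : ℕ
    m : ℕ
    ends : Fin m → Fin n × Fin n

module _ (G : Graph) where
  open Graph G

  Joins : Fin m → Fin n → Fin n → Set
  Joins e x y = (ends e ≡ (x , y)) ⊎ (ends e ≡ (y , x))

  -- a walk: start vertex u and steps (edge , next vertex)
  IsWalk : Fin n → List (Fin m × Fin n) → Set
  IsWalk u [] = ⊤
  IsWalk u ((e , v) ∷ s) = Joins e u v × IsWalk v s

lastV : ∀ {n m : ℕ} → Fin n → List (Fin m × Fin n) → Fin n
lastV u [] = u
lastV u ((e , v) ∷ s) = lastV v s

-- an ear (path or cycle), represented as a walk
record Ear (n m : ℕ) : Set where
  constructor ear
  field
    start : Fin n
    steps : List (Fin m × Fin n)

module _ {n m : ℕ} where
  verts : Ear n m → List (Fin n)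
  verts P = Ear.start P ∷ map proj₂ (Ear.steps P)

  edges : Ear n m → List (Fin m)
  edges P = map proj₁ (Ear.steps P)

  finish : Ear n m → Fin n
  finish P = lastV (Ear.start P) (Ear.steps P)

  Short : Ear n m → Set
  Short P = length (Ear.steps P) ≡ 1

module _ (G : Graph) where
  open Graph G

  IsPath : Ear n m → Set
  IsPath P = IsWalk G (Ear.start P) (Ear.steps P) × Ear.steps P ≢ [] × Unique (verts P)

  -- a closed walk with at least one edge, distinct vertices v1..vk (vk = v0)
  -- and distinct edges
  IsCycle : Ear n m → Set
  IsCycle P = IsWalk G (Ear.start P) (Ear.steps P) × Ear.steps P ≢ []
            × finish P ≡ Ear.start P
            × Unique (map proj₂ (Ear.steps P)) × Unique (edges P)

  module _ {k : ℕ} (D : Fin (suc k) → Ear n m) where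

    VPrev : Fin (suc k) → Fin n → Set
    VPrev i v = ∃[ j ] (toℕ j < toℕ i × v ∈ verts (D j))

    Inner : Fin (suc k) → Fin n → Set
    Inner i v = v ∈ verts (D i) × ¬ VPrev i v

    EBar : Fin (suc k) → Fin m → Set
    EBar i e = ∃[ j ] (toℕ i < toℕ j × e ∈ edges (D j))

    VBar : Fin (suc k) → Fin n → Set
    VBar i v = ∃[ e ] (EBar i e × ∃[ w ] Joins G e v w)

    BarConnected : Fin (suc k) → Set
    BarConnected i = ∀ x y → VBar i x → VBar i y →
      ∃[ s ] (IsWalk G x s × All (λ st → EBar i (proj₁ st)) s × lastV x s ≡ y)

    IsEarAt : Fin (suc k) → Set
    IsEarAt i =
        (IsPath (D i) × VPrev i (Ear.start (D i)) × VPrev i (finish (D i))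
          × (∀ v → v ∈ verts (D i) → VPrev i v → (v ≡ Ear.start (D i)) ⊎ (v ≡ finish (D i))))
      ⊎ (IsCycle (D i) × VPrev i (Ear.start (D i))
          × (∀ v → v ∈ verts (D i) → VPrev i v → v ≡ Ear.start (D i)))

    IsEarDecomposition : Set
    IsEarDecomposition =
        (IsCycle (D Fin.zero) × ¬ Short (D Fin.zero))
      × (∀ (i : Fin (suc k)) → 0 < toℕ i → IsEarAt i)
      × (∀ e → ∃[ i ] (e ∈ edges (D i) × (∀ j → e ∈ edges (D j) → j ≡ i)))

  record TwoOneEdgeOrder (rt ru : Fin m) (D : Fin (suc (m ∸ n)) → Ear n m) : Set where
    field
      earDec : IsEarDecomposition D
      through : rt ∈ edges (D Fin.zero)
      lastEar : edges (D (fromℕ (m ∸ n))) ≡ ru ∷ []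
      cond3 : ∀ (i : Fin (suc (m ∸ n))) → toℕ i < m ∸ n →
                (∀ v → Inner D i v → VBar D i v)
              × (Short (D i) → VBar D i (Ear.start (D i)) ⊎ VBar D i (finish (D i)))

-- Every vertex of the complement graph of G_i is joined to r inside it, by downward
-- induction on i.  For i = m-n-1 the complement is the single edge ru.  A vertex of
-- the complement of G_i lies on an edge of some later ear P_j: if j > i+1 the
-- induction hypothesis applies; if j = i+1, walk along P_{i+1} to its start and back
-- to a vertex of P_{i+1} that condition (3) places in the complement of G_{i+1}
-- (an inner vertex, or an endpoint if P_{i+1} is short), whence r is reachable.
module Submission where

open import Defs
open import Data.Nat using (ℕ; zero; suc; _<_; _≤_; _∸_; _+_; s≤s; z≤n)
open import Data.Nat.Properties
  using (m≤n⇒m<n∨m≡n; ≤-refl; ≤-antisym; <⇒≤; +-suc; +-identityʳ; m≤m+n; m≤n⇒∃[o]m+o≡n)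
open import Data.Fin using (Fin; toℕ; fromℕ)
open import Data.Fin.Properties using (toℕ-injective; toℕ-fromℕ; toℕ≤pred[n])
open import Data.Product using (_×_; _,_; proj₁; proj₂; ∃-syntax)
open import Data.Sum using (_⊎_; inj₁; inj₂)
open import Data.Empty using (⊥-elim)
open import Function using (_∘_)
open import Data.List using (List; []; _∷_; map)
open import Data.List.Membership.Propositional using (_∈_)
open import Data.List.Relation.Unary.Any using (here; there)
open import Data.List.Relation.Unary.All using (All; []; _∷_; lookup)
open import Data.List.Relation.Unary.AllPairs using (_∷_)
open import Relation.Nullary using (¬_)
open import Relation.Binary.PropositionalEquality
  using (_≡_; _≢_; refl; sym; trans; cong; subst)

lastV∈ : ∀ {n m} (v : Fin n) (s : List (Fin m × Fin n)) → lastV v s ∈ v ∷ map proj₂ s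
lastV∈ v []            = here refl
lastV∈ v ((_ , w) ∷ s) = there (lastV∈ w s)

module _ (G : Graph) where
  open Graph G

  Joins-sym : ∀ {e x y} → Joins G e x y → Joins G e y x
  Joins-sym (inj₁ p) = inj₂ p
  Joins-sym (inj₂ p) = inj₁ p

  Joins-end : ∀ {e a b x w} → Joins G e a b → Joins G e x w → x ≡ a ⊎ x ≡ b
  Joins-end (inj₁ p) (inj₁ q) = inj₁ (cong proj₁ (trans (sym q) p))
  Joins-end (inj₁ p) (inj₂ q) = inj₂ (cong proj₂ (trans (sym q) p))
  Joins-end (inj₂ p) (inj₁ q) = inj₂ (cong proj₁ (trans (sym q) p))
  Joins-end (inj₂ p) (inj₂ q) = inj₁ (cong proj₂ (trans (sym q) p))

  data Reach (Q : Fin m → Set) : Fin n → Fin n → Set where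
    ε    : ∀ {x} → Reach Q x x
    step : ∀ {e x y z} → Q e → Joins G e x y → Reach Q y z → Reach Q x z

  module _ {Q : Fin m → Set} where

    Reach-trans : ∀ {x y z} → Reach Q x y → Reach Q y z → Reach Q x z
    Reach-trans ε            b = b
    Reach-trans (step q j a) b = step q j (Reach-trans a b)

    Reach-sym : ∀ {x y} → Reach Q x y → Reach Q y x
    Reach-sym ε            = ε
    Reach-sym (step q j a) = Reach-trans (Reach-sym a) (step q (Joins-sym j) ε)

    Reach-mono : ∀ {Q′ : Fin m → Set} → (∀ {e} → Q e → Q′ e) →
                 ∀ {x y} → Reach Q x y → Reach Q′ x y
    Reach-mono f ε            = ε
    Reach-mono f (step q j a) = step (f q) j (Reach-mono f a)

    Reach⇒walk : ∀ {x y} → Reach Q x y →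
      ∃[ s ] (IsWalk G x s × All (λ st → Q (proj₁ st)) s × lastV x s ≡ y)
    Reach⇒walk ε = [] , _ , [] , refl
    Reach⇒walk (step {e} {y = y} q j a) with Reach⇒walk a
    ... | s , w , qs , eq = (e , y) ∷ s , (j , w) , q ∷ qs , eq

    walk-vertex-reaches-start : ∀ x s → IsWalk G x s → (∀ e → e ∈ map proj₁ s → Q e) →
      ∀ {v} → v ∈ x ∷ map proj₂ s → Reach Q v x
    walk-vertex-reaches-start x s w qs (here refl) = ε
    walk-vertex-reaches-start x ((e , y) ∷ s) (j , w) qs (there v∈) =
      Reach-trans (walk-vertex-reaches-start y s w (λ e′ → qs e′ ∘ there) v∈)
                  (step (qs e (here refl)) (Joins-sym j) ε)

  walk-endpoint∈ : ∀ x s → IsWalk G x s → ∀ {e v w} →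
    e ∈ map proj₁ s → Joins G e v w → v ∈ x ∷ map proj₂ s
  walk-endpoint∈ x ((_ , y) ∷ s) (j , _) (here refl) jv with Joins-end j jv
  ... | inj₁ refl = here refl
  ... | inj₂ refl = there (here refl)
  walk-endpoint∈ x ((_ , y) ∷ s) (_ , w) (there e∈) jv = there (walk-endpoint∈ y s w e∈ jv)

  IsEarOver : (Fin n → Set) → Ear n m → Set
  IsEarOver Old P =
      (IsPath G P × Old (Ear.start P) × Old (finish P)
        × (∀ v → v ∈ verts P → Old v → v ≡ Ear.start P ⊎ v ≡ finish P))
    ⊎ (IsCycle G P × Old (Ear.start P)
        × (∀ v → v ∈ verts P → Old v → v ≡ Ear.start P))

  IsEarOver⇒walk : ∀ {Old P} → IsEarOver Old P → IsWalk G (Ear.start P) (Ear.steps P)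
  IsEarOver⇒walk (inj₁ ((w , _) , _)) = w
  IsEarOver⇒walk (inj₂ ((w , _) , _)) = w

  -- The second vertex of a long ear is inner: it is neither endpoint, by distinctness.
  ear-meets : ∀ {Old P} (New : Fin n → Set) → IsEarOver Old P →
    (∀ v → v ∈ verts P × ¬ Old v → New v) →
    (Short P → New (Ear.start P) ⊎ New (finish P)) →
    ∃[ z ] (z ∈ verts P × New z)
  ear-meets {P = ear x []} New (inj₁ ((_ , ne , _) , _)) _ _ = ⊥-elim (ne refl)
  ear-meets {P = ear x []} New (inj₂ ((_ , ne , _) , _)) _ _ = ⊥-elim (ne refl)
  ear-meets {P = ear x ((_ , y) ∷ [])} New _ _ short with short refl
  ... | inj₁ new = x , here refl , new
  ... | inj₂ new = y , there (here refl) , new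
  ear-meets {Old} {ear x ((_ , y) ∷ (_ , y′) ∷ s)} New isEar inner _ =
    y , there (here refl) , inner y (there (here refl) , y-new isEar)
    where
    y-new : IsEarOver Old (ear x ((_ , y) ∷ (_ , y′) ∷ s)) → ¬ Old y
    y-new (inj₁ ((_ , _ , (x≢ ∷ (y≢ ∷ _))) , _ , _ , ends)) old with ends y (there (here refl)) old
    ... | inj₁ y≡x   = lookup x≢ (here refl) (sym y≡x)
    ... | inj₂ y≡end = lookup y≢ (lastV∈ y′ s) y≡end
    y-new (inj₂ ((_ , _ , closed , (y≢ ∷ _) , _) , _ , ends)) old =
      lookup y≢ (lastV∈ y′ s) (trans (ends y (there (here refl)) old) (sym closed))

module _ (G : Graph) {rt ru : Fin (Graph.m G)} {r u : Fin (Graph.n G)} (ru-joins : Joins G ru r u)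
  {D : Fin (suc (Graph.m G ∸ Graph.n G)) → Ear (Graph.n G) (Graph.m G)}
  (T : TwoOneEdgeOrder G rt ru D) where
  open Graph G
  open TwoOneEdgeOrder T

  M : ℕ
  M = m ∸ n

  -- EBar and VBar indexed by ℕ, so that the induction can run on i without a Fin bound.
  Later : ℕ → Fin m → Set
  Later i e = ∃[ j ] (i < toℕ j × e ∈ edges (D j))

  Touches : ℕ → Fin n → Set
  Touches i x = ∃[ e ] (Later i e × ∃[ w ] Joins G e x w)

  ReachesR : ℕ → Set
  ReachesR i = ∀ x → Touches i x → Reach G (Later i) x r

  Later-suc : ∀ {i e} → Later (suc i) e → Later i e
  Later-suc (j , i<j , e∈) = j , <⇒≤ i<j , e∈

  Later-last : ∀ {i e} → suc i ≡ M → Later i e → e ≡ ru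
  Later-last {e = e} last (j , i<j , e∈) =
    ∈-singleton (subst (e ∈_) lastEar (subst (λ k → e ∈ edges (D k)) j≡M e∈))
    where
    j≡M : j ≡ fromℕ M
    j≡M = toℕ-injective (trans (≤-antisym (toℕ≤pred[n] j) (subst (_≤ toℕ j) last i<j))
                               (sym (toℕ-fromℕ M)))
    ∈-singleton : e ∈ ru ∷ [] → e ≡ ru
    ∈-singleton (here e≡ru) = e≡ru

  ReachesR-last : ∀ {i} → suc i ≡ M → ReachesR i
  ReachesR-last last x (e , later , _ , joins) with Later-last last later
  ... | refl with Joins-end G ru-joins joins
  ...   | inj₁ refl = ε
  ...   | inj₂ refl = step later (Joins-sym G ru-joins) ε

  next-ear-reaches : ∀ {i} j → toℕ j ≡ suc i → toℕ j < M → ReachesR (suc i) →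
    ∀ {e x w} → e ∈ edges (D j) → Joins G e x w → Reach G (Later i) x r
  next-ear-reaches {i} j j≡ j<M IH e∈ joins =
    Reach-trans G (to-start (walk-endpoint∈ G _ _ walk e∈ joins))
                  (Reach-trans G (Reach-sym G (to-start z∈)) (Reach-mono G Later-suc z↝r))
    where
    isEar = proj₁ (proj₂ earDec) j (subst (0 <_) (sym j≡) (s≤s z≤n))
    walk = IsEarOver⇒walk G isEar
    to-start : ∀ {v} → v ∈ verts (D j) → Reach G (Later i) v (Ear.start (D j))
    to-start = walk-vertex-reaches-start G _ _ walk (λ _ e′∈ → j , subst (i <_) (sym j≡) ≤-refl , e′∈)
    meets = ear-meets G (VBar G D j) isEar (proj₁ (cond3 j j<M)) (proj₂ (cond3 j j<M))
    z∈ = proj₁ (proj₂ meets)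
    z↝r = IH _ (subst (λ k → Touches k (proj₁ meets)) j≡ (proj₂ (proj₂ meets)))

  ReachesR-below : ∀ d i → suc (i + d) ≡ M → ReachesR i
  ReachesR-below zero    i eq = ReachesR-last (trans (cong suc (sym (+-identityʳ i))) eq)
  ReachesR-below (suc d) i eq x (e , (j , i<j , e∈) , w , joins) = by-ear (m≤n⇒m<n∨m≡n i<j)
    where
    eq′ : suc (suc i + d) ≡ M
    eq′ = trans (cong suc (sym (+-suc i d))) eq
    IH = ReachesR-below d (suc i) eq′
    i+1<M : suc i < M
    i+1<M = subst (suc (suc i) ≤_) eq′ (s≤s (s≤s (m≤m+n i d)))
    by-ear : suc i < toℕ j ⊎ suc i ≡ toℕ j → Reach G (Later i) x r
    by-ear (inj₁ i+1<j) = Reach-mono G Later-suc (IH x (e , (j , i+1<j , e∈) , w , joins))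
    by-ear (inj₂ i+1≡j) = next-ear-reaches j (sym i+1≡j) (subst (_< M) i+1≡j i+1<M) IH e∈ joins

lemma2 : (G : Graph) (r t u : Fin (Graph.n G)) (rt ru : Fin (Graph.m G)) →
    rt ≢ ru → Joins G rt r t → Joins G ru r u →
    (D : Fin (suc (Graph.m G ∸ Graph.n G)) → Ear (Graph.n G) (Graph.m G)) →
    TwoOneEdgeOrder G rt ru D →
    (i : Fin (suc (Graph.m G ∸ Graph.n G))) → toℕ i < Graph.m G ∸ Graph.n G →
    BarConnected G D i
lemma2 G r t u rt ru _ _ ru-joins D T i i<M x y x∈ y∈ =
  Reach⇒walk G (Reach-trans G (reaches-r x x∈) (Reach-sym G (reaches-r y y∈)))
  where
  gap = m≤n⇒∃[o]m+o≡n i<M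
  reaches-r = ReachesR-below G ru-joins T (proj₁ gap) (toℕ i) (proj₂ gap)
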